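{- Write $\beta_2(r) = \beta_2(r,r-1)$ for $r \ge 3$. Then either $\beta_2(r) = 3r-6$ for all $r \ge 3$, or there is a constant $c < 3$ such that $\beta_2(r) \le (c+o(1))r$ as $r \to \infty$.
   Context: A $k$-partite graph comes with a fixed partition of its vertex set into $k$ parts (parts may be empty). For $k \ge r \ge 2$ and $1 \le i \le k-r+1$, $\beta_i(k,r)$ is the minimum number of vertices of a $K_r$-free $k$-partite graph such that, for every choice of $k-i$ of its parts, the subgraph induced by those parts contains a $K_{r-1}$. -}

module Defs where

open import Data.Nat using (ℕ; _∸_; _<_; _≤_; _*_; _+_)
open import Data.Fin using (Fin)
open import Data.Fin.Subset using (Subset; _∈_; ∣_∣)
open import Data.Bool using (Bool; true; false)
open import Data.Product using (Σ; _×_; ∃)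
open import Relation.Binary.PropositionalEquality using (_≡_; _≢_)
open import Relation.Nullary using (¬_)

-- A k-partite (simple, undirected) graph on the vertex set Fin n, with a fixed
-- partition of the vertices into k (possibly empty) parts given by `part`.
record KPartiteGraph (k n : ℕ) : Set where
  field
    part  : Fin n → Fin k
    adj   : Fin n → Fin n → Bool
    sym   : ∀ u v → adj u v ≡ adj v u
    irr   : ∀ v → adj v v ≡ false
    cross : ∀ u v → adj u v ≡ true → part u ≢ part v
open KPartiteGraph public

-- A copy of K_s in G: s vertices, pairwise adjacent (hence distinct).
Clique : ∀ {k n} → KPartiteGraph k n → ℕ → Set
Clique {n = n} G s =
  Σ (Fin s → Fin n) λ f → ∀ i j → i ≢ j → adj G (f i) (f j) ≡ true

CliqueIn : ∀ {k n} → KPartiteGraph k n → Subset k → ℕ → Set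
CliqueIn {n = n} G S s =
  Σ (Fin s → Fin n) λ f →
    (∀ i j → i ≢ j → adj G (f i) (f j) ≡ true) × (∀ i → part G (f i) ∈ S)

KrFree : ∀ {k n} → KPartiteGraph k n → ℕ → Set
KrFree G r = ¬ Clique G r

Good : ℕ → ℕ → ℕ → ℕ → Set
Good i k r n =
  Σ (KPartiteGraph k n) λ G →
    KrFree G r × (∀ (S : Subset k) → ∣ S ∣ ≡ k ∸ i → CliqueIn G S (r ∸ 1))

IsBeta : ℕ → ℕ → ℕ → ℕ → Set
IsBeta i k r b = Good i k r b × (∀ m → m < b → ¬ Good i k r m)

IsBeta₂ : ℕ → ℕ → Set
IsBeta₂ r b = IsBeta 2 r (r ∸ 1) b

module Submission where

-- Write s = r − 2. A graph witnessing β₂(r) ≤ n is an (s+2)-partite, K_{s+1}-free graph on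
-- n vertices in which, for any two parts p and q, some K_s avoids p and q; we call such a
-- graph s-pair-avoiding. Everything rests on one construction: gluing an s₁-pair-avoiding
-- graph and an s₂-pair-avoiding graph along two shared parts, keeping all other parts
-- apart and joining the two graphs across differing parts, yields an (s₁+s₂)-pair-avoiding
-- graph on n₁ + n₂ vertices. Gluing copies of three isolated vertices gives β₂(r) ≤ 3s.
-- Gluing ⌊s/s₀⌋ copies of one s₀-pair-avoiding graph on n₀ < 3s₀ vertices with fewer than
-- s₀ such triples gives s₀·β₂(r) ≤ n₀·s + 3s₀², the second alternative with c = n₀/s₀.
-- So either no graph beats 3s, and then β₂(r) = 3s exactly, or the second alternative
-- holds; which one is not decidable, hence the disjunction is proved under ¬¬.

open import Defs
open import Data.Nat using (ℕ; _∸_; _<_; _≤_; _*_; _+_)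
open import Data.Product using (Σ; _×_)
open import Data.Sum using (_⊎_)
open import Relation.Binary.PropositionalEquality using (_≡_)
open import Relation.Nullary using (¬_)

open import Data.Nat using (zero; suc; z≤n; s≤s; NonZero; _≤?_)
open import Data.Nat.Properties
  using (suc-injective; +-suc; +-comm; +-mono-≤; *-suc; *-assoc; *-monoʳ-≤; *-distribʳ-+; 1+n≰n; ≰⇒>;
         ≮⇒≥; <⇒≤; m≤n+m; m+n∸m≡n; *-distribˡ-+; module ≤-Reasoning)
open import Data.Nat.DivMod using (_/_; _%_; m≡m%n+[m/n]*n; m/n*n≤m; m%n<n)
open import Data.Nat.Tactic.RingSolver using (solve-∀)
open import Data.Fin using (Fin; zero; suc; _↑ˡ_; _↑ʳ_; splitAt; join; inject≤; _≟_)
open import Data.Fin.Properties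
  using (↑ˡ-injective; ↑ʳ-injective; splitAt-↑ˡ; splitAt-↑ʳ; splitAt-join; join-splitAt;
         inject≤-injective)
  renaming (suc-injective to fsuc-injective)
open import Data.Fin.Subset using (Subset; _∈_; _∉_; ∣_∣; ⊥; ⁅_⁆; ∁; inside; outside)
open import Data.Fin.Subset.Properties
  using (∈⊤; ∉⊥; ∣⊥∣≡0; ∣p∣≡n⇒p≡⊤; drop-there; x∈⁅x⁆; x∈p⇒x∉∁p; ∣∁p∣≡n∸∣p∣; ∣⁅x⁆∣≡1)
open import Data.Vec using (here; there) renaming (_∷_ to _∷ᵛ_)
open import Data.Vec.Functional using (_∷_)
open import Data.Bool using (Bool; true; false; not)
open import Data.Product using (_,_; proj₁; proj₂; uncurry) renaming (swap to swap×)
open import Data.Sum using (inj₁; inj₂; [_,_]′) renaming (map to map⊎)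
open import Data.Empty using (⊥-elim)
open import Function using (_∘_)
open import Function.Definitions using (Injective)
open import Relation.Nullary using (Dec; yes; no)
open import Relation.Nullary.Decidable using (⌊_⌋)
open import Relation.Binary.PropositionalEquality
  using (_≢_; refl; trans; cong; subst; subst₂)
  renaming (sym to ≡-sym)

Adjacent : ∀ {k n} → KPartiteGraph k n → Fin n → Fin n → Set
Adjacent G u v = adj G u v ≡ true

Pairwise : {A : Set} → (A → A → Set) → ∀ {s} → (Fin s → A) → Set
Pairwise R f = ∀ i j → i ≢ j → R (f i) (f j)

takePairwise : ∀ {A : Set} {R : A → A → Set} {s t} → s ≤ t →
               (f : Fin t → A) → Pairwise R f → Σ (Fin s → A) (Pairwise R)
takePairwise s≤t f pw =
  (λ i → f (inject≤ i s≤t)) , λ i j i≢j → pw _ _ (i≢j ∘ inject≤-injective s≤t s≤t i j)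

pairwise-∷ : ∀ {A : Set} {R : A → A → Set} {s v} {f : Fin s → A} → Pairwise R f →
             (∀ j → R v (f j)) → (∀ j → R (f j) v) → Pairwise R (v ∷ f)
pairwise-∷ pw to from zero    zero    i≢j = ⊥-elim (i≢j refl)
pairwise-∷ pw to from zero    (suc j) _   = to j
pairwise-∷ pw to from (suc i) zero    _   = from i
pairwise-∷ pw to from (suc i) (suc j) i≢j = pw i j (i≢j ∘ cong suc)

module Sorting {A B : Set} (R : A ⊎ B → A ⊎ B → Set) where

  Rˡ : A → A → Set
  Rˡ a a′ = R (inj₁ a) (inj₁ a′)

  Rʳ : B → B → Set
  Rʳ b b′ = R (inj₂ b) (inj₂ b′)

  record Sorted {k} (g : Fin k → A ⊎ B) : Set where
    field
      #left #right : ℕ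
      size         : #left + #right ≡ k
      left         : Fin #left → A
      right        : Fin #right → B
      left-pw      : Pairwise Rˡ left
      right-pw     : Pairwise Rʳ right
      left-occurs  : ∀ i → Σ (Fin k) λ j → g j ≡ inj₁ (left i)
      right-occurs : ∀ i → Σ (Fin k) λ j → g j ≡ inj₂ (right i)

  sort : ∀ {k} (g : Fin k → A ⊎ B) → Pairwise R g → Sorted g
  sort {zero} g pw = record
    { #left = 0 ; #right = 0 ; size = refl ; left = λ () ; right = λ ()
    ; left-pw = λ () ; right-pw = λ () ; left-occurs = λ () ; right-occurs = λ () }
  sort {suc k} g pw =
    insert (g zero) refl (sort (g ∘ suc) (λ i j i≢j → pw (suc i) (suc j) (i≢j ∘ fsuc-injective)))
    where
      related : ∀ i j {x y} → i ≢ j → g i ≡ x → g j ≡ y → R x y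
      related i j i≢j refl refl = pw i j i≢j

      later : ∀ {x} → Σ (Fin k) (λ j → g (suc j) ≡ x) → Σ (Fin (suc k)) λ j → g j ≡ x
      later (j , eq) = suc j , eq

      insert : ∀ x → g zero ≡ x → Sorted (g ∘ suc) → Sorted g
      insert (inj₁ v) first rest = record
        { #left = suc #left ; #right = #right ; size = cong suc size
        ; left = v ∷ left ; right = right
        ; left-pw = pairwise-∷ {R = Rˡ} left-pw
            (λ j → related zero (suc (proj₁ (left-occurs j))) (λ ()) first (proj₂ (left-occurs j)))
            (λ j → related (suc (proj₁ (left-occurs j))) zero (λ ()) (proj₂ (left-occurs j)) first)
        ; right-pw = right-pw
        ; left-occurs = λ { zero → zero , first ; (suc i) → later (left-occurs i) }
        ; right-occurs = later ∘ right-occurs }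
        where open Sorted rest
      insert (inj₂ w) first rest = record
        { #left = #left ; #right = suc #right ; size = trans (+-suc #left #right) (cong suc size)
        ; left = left ; right = w ∷ right
        ; left-pw = left-pw
        ; right-pw = pairwise-∷ {R = Rʳ} right-pw
            (λ j → related zero (suc (proj₁ (right-occurs j))) (λ ()) first (proj₂ (right-occurs j)))
            (λ j → related (suc (proj₁ (right-occurs j))) zero (λ ()) (proj₂ (right-occurs j)) first)
        ; left-occurs = later ∘ left-occurs
        ; right-occurs = λ { zero → zero , first ; (suc i) → later (right-occurs i) } }
        where open Sorted rest

  largeSide : ∀ {s₁ s₂} (g : Fin (suc (s₁ + s₂)) → A ⊎ B) → Pairwise R g →
              Σ (Fin (suc s₁) → A) (Pairwise Rˡ) ⊎ Σ (Fin (suc s₂) → B) (Pairwise Rʳ)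
  largeSide {s₁} {s₂} g pw = decide (#left ≤? s₁) (#right ≤? s₂)
    where
      open Sorted (sort g pw)

      decide : Dec (#left ≤ s₁) → Dec (#right ≤ s₂) →
               Σ (Fin (suc s₁) → A) (Pairwise Rˡ) ⊎ Σ (Fin (suc s₂) → B) (Pairwise Rʳ)
      decide (yes fewLeft) (yes fewRight) =
        ⊥-elim (1+n≰n (subst (_≤ s₁ + s₂) size (+-mono-≤ fewLeft fewRight)))
      decide (no manyLeft)  _              = inj₁ (takePairwise {R = Rˡ} (≰⇒> manyLeft) left left-pw)
      decide (yes _)        (no manyRight) = inj₂ (takePairwise {R = Rʳ} (≰⇒> manyRight) right right-pw)

open Sorting using (largeSide)

AvoidsParts : ∀ {k n s} → KPartiteGraph k n → (Fin s → Fin n) → Fin k → Fin k → Set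
AvoidsParts G f p q = ∀ i → part G (f i) ≢ p × part G (f i) ≢ q

differ : ∀ {k} → Fin k → Fin k → Bool
differ x y = not ⌊ x ≟ y ⌋

differ-sound : ∀ {k} {x y : Fin k} → differ x y ≡ true → x ≢ y
differ-sound {x = x} {y} d with x ≟ y | d
... | yes _   | ()
... | no x≢y | _ = x≢y

differ-complete : ∀ {k} {x y : Fin k} → x ≢ y → differ x y ≡ true
differ-complete {x = x} {y} x≢y with x ≟ y
... | yes x≡y = ⊥-elim (x≢y x≡y)
... | no _ = refl

module Glue {k k₁ k₂ n₁ n₂ : ℕ} (G₁ : KPartiteGraph k₁ n₁) (G₂ : KPartiteGraph k₂ n₂)
            (φ₁ : Fin k₁ → Fin k) (φ₂ : Fin k₂ → Fin k)
            (φ₁-inj : Injective _≡_ _≡_ φ₁) (φ₂-inj : Injective _≡_ _≡_ φ₂) where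

  Vertex : Set
  Vertex = Fin n₁ ⊎ Fin n₂

  partᵛ : Vertex → Fin k
  partᵛ (inj₁ u) = φ₁ (part G₁ u)
  partᵛ (inj₂ w) = φ₂ (part G₂ w)

  adjᵛ : Vertex → Vertex → Bool
  adjᵛ (inj₁ u) (inj₁ u′) = adj G₁ u u′
  adjᵛ (inj₂ w) (inj₂ w′) = adj G₂ w w′
  adjᵛ (inj₁ u) (inj₂ w)  = differ (partᵛ (inj₁ u)) (partᵛ (inj₂ w))
  adjᵛ (inj₂ w) (inj₁ u)  = differ (partᵛ (inj₁ u)) (partᵛ (inj₂ w))

  Adjacentᵛ : Vertex → Vertex → Set
  Adjacentᵛ x y = adjᵛ x y ≡ true

  adjᵛ-sym : ∀ x y → adjᵛ x y ≡ adjᵛ y x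
  adjᵛ-sym (inj₁ u) (inj₁ u′) = KPartiteGraph.sym G₁ u u′
  adjᵛ-sym (inj₂ w) (inj₂ w′) = KPartiteGraph.sym G₂ w w′
  adjᵛ-sym (inj₁ u) (inj₂ w)  = refl
  adjᵛ-sym (inj₂ w) (inj₁ u)  = refl

  adjᵛ-irr : ∀ x → adjᵛ x x ≡ false
  adjᵛ-irr (inj₁ u) = irr G₁ u
  adjᵛ-irr (inj₂ w) = irr G₂ w

  adjᵛ-cross : ∀ x y → Adjacentᵛ x y → partᵛ x ≢ partᵛ y
  adjᵛ-cross (inj₁ u) (inj₁ u′) e = cross G₁ u u′ e ∘ φ₁-inj
  adjᵛ-cross (inj₂ w) (inj₂ w′) e = cross G₂ w w′ e ∘ φ₂-inj
  adjᵛ-cross (inj₁ u) (inj₂ w)  e = differ-sound e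
  adjᵛ-cross (inj₂ w) (inj₁ u)  e = differ-sound e ∘ ≡-sym

  glued : KPartiteGraph k (n₁ + n₂)
  glued = record
    { part  = partᵛ ∘ splitAt n₁
    ; adj   = λ u v → adjᵛ (splitAt n₁ u) (splitAt n₁ v)
    ; sym   = λ u v → adjᵛ-sym (splitAt n₁ u) (splitAt n₁ v)
    ; irr   = adjᵛ-irr ∘ splitAt n₁
    ; cross = λ u v → adjᵛ-cross (splitAt n₁ u) (splitAt n₁ v) }

  -- A K_{s₁+s₂+1} of the glued graph would contain a K_{s₁+1} of G₁ or a K_{s₂+1} of G₂.
  glued-free : ∀ {s₁ s₂} → KrFree G₁ (suc s₁) → KrFree G₂ (suc s₂) → KrFree glued (suc (s₁ + s₂))
  glued-free free₁ free₂ (f , isClique) =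
    [ free₁ , free₂ ]′ (largeSide Adjacentᵛ (splitAt n₁ ∘ f) isClique)

  module _ {s₁ s₂} (f₁ : Fin s₁ → Fin n₁) (f₂ : Fin s₂ → Fin n₂) where

    joinFamily : Fin (s₁ + s₂) → Fin (n₁ + n₂)
    joinFamily i = join n₁ n₂ (map⊎ f₁ f₂ (splitAt s₁ i))

    joinFamily-vertex : ∀ i → splitAt n₁ (joinFamily i) ≡ map⊎ f₁ f₂ (splitAt s₁ i)
    joinFamily-vertex i = splitAt-join n₁ n₂ _

    joinFamily-clique : Pairwise (Adjacent G₁) f₁ → Pairwise (Adjacent G₂) f₂ →
                        (∀ a b → φ₁ (part G₁ (f₁ a)) ≢ φ₂ (part G₂ (f₂ b))) →
                        Pairwise (Adjacent glued) joinFamily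
    joinFamily-clique clique₁ clique₂ apart i j i≢j =
      subst₂ Adjacentᵛ (≡-sym (joinFamily-vertex i)) (≡-sym (joinFamily-vertex j))
        (onSum (splitAt s₁ i) (splitAt s₁ j) (i≢j ∘ splitAt-injective))
      where
        splitAt-injective : splitAt s₁ i ≡ splitAt s₁ j → i ≡ j
        splitAt-injective e =
          trans (≡-sym (join-splitAt s₁ s₂ i)) (trans (cong (join s₁ s₂) e) (join-splitAt s₁ s₂ j))

        onSum : ∀ w w′ → w ≢ w′ → Adjacentᵛ (map⊎ f₁ f₂ w) (map⊎ f₁ f₂ w′)
        onSum (inj₁ a) (inj₁ a′) w≢w′ = clique₁ a a′ (w≢w′ ∘ cong inj₁)
        onSum (inj₂ b) (inj₂ b′) w≢w′ = clique₂ b b′ (w≢w′ ∘ cong inj₂)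
        onSum (inj₁ a) (inj₂ b)  _    = differ-complete (apart a b)
        onSum (inj₂ b) (inj₁ a)  _    = differ-complete (apart a b)

    joinFamily-avoids : ∀ {p q} →
      (∀ a → φ₁ (part G₁ (f₁ a)) ≢ p × φ₁ (part G₁ (f₁ a)) ≢ q) →
      (∀ b → φ₂ (part G₂ (f₂ b)) ≢ p × φ₂ (part G₂ (f₂ b)) ≢ q) →
      AvoidsParts glued joinFamily p q
    joinFamily-avoids avoids₁ avoids₂ i rewrite joinFamily-vertex i with splitAt s₁ i
    ... | inj₁ a = avoids₁ a
    ... | inj₂ b = avoids₂ b

module SharedParts (s₁ s₂ : ℕ) where

  Part : Set
  Part = Fin (2 + (s₁ + s₂))

  embed₁ : Fin (2 + s₁) → Part
  embed₁ x = x ↑ˡ s₂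

  embed₂ : Fin (2 + s₂) → Part
  embed₂ zero          = zero
  embed₂ (suc zero)    = suc zero
  embed₂ (suc (suc b)) = suc (suc (s₁ ↑ʳ b))

  embed₁-inj : Injective _≡_ _≡_ embed₁
  embed₁-inj = ↑ˡ-injective s₂ _ _

  embed₂-inj : Injective _≡_ _≡_ embed₂
  embed₂-inj {zero}          {zero}          _ = refl
  embed₂-inj {suc zero}      {suc zero}      _ = refl
  embed₂-inj {suc (suc b)}   {suc (suc b′)}  e =
    cong (λ c → suc (suc c)) (↑ʳ-injective s₁ b b′ (fsuc-injective (fsuc-injective e)))
  embed₂-inj {zero}          {suc zero}      ()
  embed₂-inj {zero}          {suc (suc _)}   ()
  embed₂-inj {suc zero}      {zero}          ()
  embed₂-inj {suc zero}      {suc (suc _)}   ()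
  embed₂-inj {suc (suc _)}   {zero}          ()
  embed₂-inj {suc (suc _)}   {suc zero}      ()

  embeds-meet : ∀ {x y} → embed₁ x ≡ embed₂ y → (x ≡ zero × y ≡ zero) ⊎ (x ≡ suc zero × y ≡ suc zero)
  embeds-meet {zero}        {zero}        _ = inj₁ (refl , refl)
  embeds-meet {suc zero}    {suc zero}    _ = inj₂ (refl , refl)
  embeds-meet {suc (suc a)} {suc (suc b)} e with
    trans (≡-sym (splitAt-↑ˡ s₁ a s₂))
          (trans (cong (splitAt s₁) (fsuc-injective (fsuc-injective e))) (splitAt-↑ʳ s₁ s₂ b))
  ... | ()
  embeds-meet {zero}        {suc zero}    ()
  embeds-meet {zero}        {suc (suc _)} ()
  embeds-meet {suc zero}    {zero}        ()
  embeds-meet {suc zero}    {suc (suc _)} ()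
  embeds-meet {suc (suc _)} {zero}        ()
  embeds-meet {suc (suc _)} {suc zero}    ()

  apart₁ : ∀ {x y} → x ≢ zero → x ≢ suc zero → embed₁ x ≢ embed₂ y
  apart₁ x≢0 x≢1 e = [ x≢0 ∘ proj₁ , x≢1 ∘ proj₁ ]′ (embeds-meet e)

  apart₂ : ∀ {x y} → y ≢ zero → y ≢ suc zero → embed₁ x ≢ embed₂ y
  apart₂ y≢0 y≢1 e = [ y≢0 ∘ proj₂ , y≢1 ∘ proj₂ ]′ (embeds-meet e)

  record Avoidance (p q : Part) : Set where
    field
      e₁ e₁′ : Fin (2 + s₁)
      e₂ e₂′ : Fin (2 + s₂)
      avoid₁ : ∀ x → x ≢ e₁ → x ≢ e₁′ → embed₁ x ≢ p × embed₁ x ≢ q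
      avoid₂ : ∀ y → y ≢ e₂ → y ≢ e₂′ → embed₂ y ≢ p × embed₂ y ≢ q
      apart  : ∀ x y → x ≢ e₁ → x ≢ e₁′ → y ≢ e₂ → y ≢ e₂′ → embed₁ x ≢ embed₂ y

  swap : ∀ {p q} → Avoidance p q → Avoidance q p
  swap av = record
    { e₁ = e₁ ; e₁′ = e₁′ ; e₂ = e₂ ; e₂′ = e₂′
    ; avoid₁ = λ x ne ne′ → swap× (avoid₁ x ne ne′)
    ; avoid₂ = λ y ne ne′ → swap× (avoid₂ y ne ne′)
    ; apart = apart }
    where open Avoidance av

  avoid-left : ∀ x x′ → Avoidance (embed₁ x) (embed₁ x′)
  avoid-left x x′ = record
    { e₁ = x ; e₁′ = x′ ; e₂ = zero ; e₂′ = suc zero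
    ; avoid₁ = λ z z≢x z≢x′ → z≢x ∘ embed₁-inj , z≢x′ ∘ embed₁-inj
    ; avoid₂ = λ y y≢0 y≢1 → apart₂ y≢0 y≢1 ∘ ≡-sym , apart₂ y≢0 y≢1 ∘ ≡-sym
    ; apart = λ _ _ _ _ y≢0 y≢1 → apart₂ y≢0 y≢1 }

  avoid-right : ∀ y y′ → Avoidance (embed₂ y) (embed₂ y′)
  avoid-right y y′ = record
    { e₁ = zero ; e₁′ = suc zero ; e₂ = y ; e₂′ = y′
    ; avoid₁ = λ x x≢0 x≢1 → apart₁ x≢0 x≢1 , apart₁ x≢0 x≢1
    ; avoid₂ = λ z z≢y z≢y′ → z≢y ∘ embed₂-inj , z≢y′ ∘ embed₂-inj
    ; apart = λ _ _ x≢0 x≢1 _ _ → apart₁ x≢0 x≢1 }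

  -- p private to G₁, q private to G₂: each side avoids its own part and one shared part.
  avoid-mixed : ∀ a b → Avoidance (embed₁ (suc (suc a))) (embed₂ (suc (suc b)))
  avoid-mixed a b = record
    { e₁ = suc (suc a) ; e₁′ = zero ; e₂ = suc zero ; e₂′ = suc (suc b)
    ; avoid₁ = λ x x≢a _ → x≢a ∘ embed₁-inj , apart₂ {y = suc (suc b)} (λ ()) (λ ())
    ; avoid₂ = λ y _ y≢b → apart₁ {x = suc (suc a)} (λ ()) (λ ()) ∘ ≡-sym , y≢b ∘ embed₂-inj
    ; apart = λ _ _ _ x≢0 y≢1 _ e → [ x≢0 ∘ proj₁ , y≢1 ∘ proj₂ ]′ (embeds-meet e) }

  data Side : Part → Set where
    fromLeft  : ∀ x → Side (embed₁ x)
    fromRight : ∀ b → Side (embed₂ (suc (suc b)))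

  side : ∀ p → Side p
  side zero          = fromLeft zero
  side (suc zero)    = fromLeft (suc zero)
  side (suc (suc z)) = sideOf (splitAt s₁ z) (join-splitAt s₁ s₂ z)
    where
      sideOf : ∀ w → join s₁ s₂ w ≡ z → Side (suc (suc z))
      sideOf (inj₁ a) refl = fromLeft (suc (suc a))
      sideOf (inj₂ b) refl = fromRight b

  -- p from G₁, q private to G₂: a shared p is handled like two parts of G₂.
  avoid-left-right : ∀ x b → Avoidance (embed₁ x) (embed₂ (suc (suc b)))
  avoid-left-right zero          b = avoid-right zero (suc (suc b))
  avoid-left-right (suc zero)    b = avoid-right (suc zero) (suc (suc b))
  avoid-left-right (suc (suc a)) b = avoid-mixed a b

  avoidance : ∀ p q → Avoidance p q
  avoidance p q with side p | side q
  ... | fromLeft x  | fromLeft x′  = avoid-left x x′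
  ... | fromRight b | fromRight b′ = avoid-right (suc (suc b)) (suc (suc b′))
  ... | fromLeft x  | fromRight b  = avoid-left-right x b
  ... | fromRight b | fromLeft x   = swap (avoid-left-right x b)

PairAvoiding : ℕ → ℕ → Set
PairAvoiding s n =
  Σ (KPartiteGraph (2 + s) n) λ G → KrFree G (suc s) ×
    (∀ p q → Σ (Fin s → Fin n) λ f → Pairwise (Adjacent G) f × AvoidsParts G f p q)

combine : ∀ {s₁ s₂ n₁ n₂} → PairAvoiding s₁ n₁ → PairAvoiding s₂ n₂ →
          PairAvoiding (s₁ + s₂) (n₁ + n₂)
combine {s₁} {s₂} {n₁} {n₂} (G₁ , free₁ , avoiding₁) (G₂ , free₂ , avoiding₂) =
  glued , glued-free free₁ free₂ , λ p q → joinAvoiding (avoidance p q)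
  where
    open SharedParts s₁ s₂
    open Glue G₁ G₂ embed₁ embed₂ embed₁-inj embed₂-inj

    joinAvoiding : ∀ {p q} → Avoidance p q → Σ (Fin (s₁ + s₂) → Fin (n₁ + n₂)) λ f →
                   Pairwise (Adjacent glued) f × AvoidsParts glued f p q
    joinAvoiding {p} {q} av with avoiding₁ (Avoidance.e₁ av) (Avoidance.e₁′ av)
                               | avoiding₂ (Avoidance.e₂ av) (Avoidance.e₂′ av)
    ... | f₁ , clique₁ , misses₁ | f₂ , clique₂ , misses₂ =
      joinFamily f₁ f₂ , joinFamily-clique f₁ f₂ clique₁ clique₂ separated ,
      joinFamily-avoids f₁ f₂ kept₁ kept₂
      where
        open Avoidance av

        separated : ∀ a b → embed₁ (part G₁ (f₁ a)) ≢ embed₂ (part G₂ (f₂ b))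
        separated a b = uncurry (uncurry (apart _ _) (misses₁ a)) (misses₂ b)

        kept₁ : ∀ a → embed₁ (part G₁ (f₁ a)) ≢ p × embed₁ (part G₁ (f₁ a)) ≢ q
        kept₁ a = uncurry (avoid₁ _) (misses₁ a)

        kept₂ : ∀ b → embed₂ (part G₂ (f₂ b)) ≢ p × embed₂ (part G₂ (f₂ b)) ≢ q
        kept₂ b = uncurry (avoid₂ _) (misses₂ b)

emptyGraph : PairAvoiding 0 0
emptyGraph = G , noVertex , λ _ _ → (λ ()) , (λ ()) , (λ ())
  where
    G : KPartiteGraph 2 0
    G = record { part = λ () ; adj = λ () ; sym = λ () ; irr = λ () ; cross = λ () }

    noVertex : KrFree G 1
    noVertex (f , _) with f zero
    ... | ()

third : ∀ (p q : Fin 3) → Σ (Fin 3) λ x → x ≢ p × x ≢ q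
third (suc _)             (suc _)             = zero , (λ ()) , (λ ())
third zero                zero                = suc zero , (λ ()) , (λ ())
third zero                (suc zero)          = suc (suc zero) , (λ ()) , (λ ())
third zero                (suc (suc zero))    = suc zero , (λ ()) , (λ ())
third (suc zero)          zero                = suc (suc zero) , (λ ()) , (λ ())
third (suc (suc zero))    zero                = suc zero , (λ ()) , (λ ())

triple : PairAvoiding 1 3
triple = G , noEdge , λ p q → let x , x≢p×x≢q = third p q in (λ _ → x) , single {x} , λ _ → x≢p×x≢q
  where
    G : KPartiteGraph 3 3
    G = record { part = λ x → x ; adj = λ _ _ → false ; sym = λ _ _ → refl
               ; irr = λ _ → refl ; cross = λ _ _ () }

    noEdge : KrFree G 2
    noEdge (f , isClique) with isClique zero (suc zero) (λ ())
    ... | ()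

    single : ∀ {v} → Pairwise (Adjacent G) {1} (λ _ → v)
    single zero zero i≢j = ⊥-elim (i≢j refl)

triples : ∀ s → PairAvoiding s (3 * s)
triples zero    = emptyGraph
triples (suc s) = subst (PairAvoiding (suc s)) (≡-sym (*-suc 3 s)) (combine triple (triples s))

copies : ∀ {s n} q → PairAvoiding s n → PairAvoiding (q * s) (q * n)
copies zero    _ = emptyGraph
copies (suc q) H = combine H (copies q H)

scaledBound : ∀ {s₀ n₀} .{{_ : NonZero s₀}} → PairAvoiding s₀ n₀ → ∀ s →
              Σ ℕ λ n → PairAvoiding s n × s₀ * n ≤ n₀ * s + 3 * s₀ * s₀
scaledBound {s₀} {n₀} H s = s / s₀ * n₀ + 3 * (s % s₀) , graph , bound
  where
    decomposition : s / s₀ * s₀ + s % s₀ ≡ s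
    decomposition = trans (+-comm (s / s₀ * s₀) (s % s₀)) (≡-sym (m≡m%n+[m/n]*n s s₀))

    graph : PairAvoiding s (s / s₀ * n₀ + 3 * (s % s₀))
    graph = subst (λ t → PairAvoiding t (s / s₀ * n₀ + 3 * (s % s₀))) decomposition
              (combine (copies (s / s₀) H) (triples (s % s₀)))

    regroup : ∀ a q c t → a * (q * c + 3 * t) ≡ c * (q * a) + 3 * a * t
    regroup = solve-∀

    bound : s₀ * (s / s₀ * n₀ + 3 * (s % s₀)) ≤ n₀ * s + 3 * s₀ * s₀
    bound = begin
      s₀ * (s / s₀ * n₀ + 3 * (s % s₀))   ≡⟨ regroup s₀ (s / s₀) n₀ (s % s₀) ⟩
      n₀ * (s / s₀ * s₀) + 3 * s₀ * (s % s₀)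
        ≤⟨ +-mono-≤ (*-monoʳ-≤ n₀ (m/n*n≤m s s₀)) (*-monoʳ-≤ (3 * s₀) (<⇒≤ (m%n<n s s₀))) ⟩
      n₀ * s + 3 * s₀ * s₀                 ∎
      where open ≤-Reasoning

full : ∀ {n} (S : Subset n) → ∣ S ∣ ≡ n → ∀ x → x ∈ S
full S size x = subst (x ∈_) (≡-sym (∣p∣≡n⇒p≡⊤ size)) ∈⊤

allButOne : ∀ {n} (S : Subset (suc n)) → ∣ S ∣ ≡ n → Σ (Fin (suc n)) λ p → ∀ x → x ≢ p → x ∈ S
allButOne (outside ∷ᵛ S) size = zero , λ { zero x≢0 → ⊥-elim (x≢0 refl) ; (suc x) _ → there (full S size x) }
allButOne {zero}  (inside ∷ᵛ S) ()
allButOne {suc n} (inside ∷ᵛ S) size with allButOne S (suc-injective size)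
... | p , others = suc p , λ { zero _ → here ; (suc x) x≢p → there (others x (x≢p ∘ cong suc)) }

allButTwo : ∀ {n} (S : Subset (2 + n)) → ∣ S ∣ ≡ n →
            Σ (Fin (2 + n)) λ p → Σ (Fin (2 + n)) λ q → ∀ x → x ≢ p → x ≢ q → x ∈ S
allButTwo (outside ∷ᵛ S) size with allButOne S size
... | p , others = zero , suc p ,
      λ { zero x≢0 _ → ⊥-elim (x≢0 refl) ; (suc x) _ x≢p → there (others x (x≢p ∘ cong suc)) }
allButTwo {zero}  (inside ∷ᵛ S) ()
allButTwo {suc n} (inside ∷ᵛ S) size with allButTwo S (suc-injective size)
... | p , q , others = suc p , suc q ,
      λ { zero _ _ → here ; (suc x) x≢p x≢q → there (others x (x≢p ∘ cong suc) (x≢q ∘ cong suc)) }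

withoutOne : ∀ {n} (p : Fin (suc n)) → Σ (Subset (suc n)) λ S → ∣ S ∣ ≡ n × p ∉ S
withoutOne {n} p =
  ∁ ⁅ p ⁆ , trans (∣∁p∣≡n∸∣p∣ ⁅ p ⁆) (cong (suc n ∸_) (∣⁅x⁆∣≡1 p)) , x∈p⇒x∉∁p (x∈⁅x⁆ p)

withoutTwo : ∀ n (p q : Fin (2 + n)) → Σ (Subset (2 + n)) λ S → ∣ S ∣ ≡ n × p ∉ S × q ∉ S
withoutTwo zero    p       q       = ⊥ , ∣⊥∣≡0 2 , ∉⊥ , ∉⊥
withoutTwo (suc n) zero    zero    with withoutOne {suc n} zero
... | S , size , _  = outside ∷ᵛ S , size , (λ ()) , (λ ())
withoutTwo (suc n) zero    (suc q) with withoutOne q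
... | S , size , q∉ = outside ∷ᵛ S , size , (λ ()) , q∉ ∘ drop-there
withoutTwo (suc n) (suc p) zero    with withoutOne p
... | S , size , p∉ = outside ∷ᵛ S , size , p∉ ∘ drop-there , (λ ())
withoutTwo (suc n) (suc p) (suc q) with withoutTwo n p q
... | S , size , p∉ , q∉ = inside ∷ᵛ S , cong suc size , p∉ ∘ drop-there , q∉ ∘ drop-there

-- Pair-avoiding graphs are exactly the graphs in the definition of β₂(s + 2): the
-- s-element sets of parts are precisely the complements of pairs of parts.
pairAvoiding⇒good : ∀ {s n} → PairAvoiding s n → Good 2 (2 + s) (suc s) n
pairAvoiding⇒good {s} (G , free , avoiding) = G , free , clique
  where
    clique : ∀ (S : Subset (2 + s)) → ∣ S ∣ ≡ s → CliqueIn G S s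
    clique S size with allButTwo S size
    ... | p , q , others with avoiding p q
    ...   | f , isClique , avoids = f , isClique , λ i → uncurry (others (part G (f i))) (avoids i)

good⇒pairAvoiding : ∀ {s n} → Good 2 (2 + s) (suc s) n → PairAvoiding s n
good⇒pairAvoiding {s} {n} (G , free , clique) = G , free , avoiding
  where
    avoiding : ∀ p q → Σ (Fin s → Fin n) λ f → Pairwise (Adjacent G) f × AvoidsParts G f p q
    avoiding p q with withoutTwo s p q
    ... | S , size , p∉ , q∉ with clique S size
    ...   | f , isClique , inS =
            f , isClique , λ i → (λ e → p∉ (subst (_∈ S) e (inS i))) , (λ e → q∉ (subst (_∈ S) e (inS i)))

β₂-minimal : ∀ {s n β} → IsBeta₂ (2 + s) β → PairAvoiding s n → β ≤ n
β₂-minimal (_ , minimal) H = ≮⇒≥ (λ n<β → minimal _ n<β (pairAvoiding⇒good H))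

-- The second alternative: for some a < 3b and every m > 0, b·β₂(r) ≤ (a + b/m)·r once r is
-- large, i.e. β₂(r) ≤ (a/b + o(1)) r.
LinearImprovement : Set
LinearImprovement =
  Σ ℕ (λ a → Σ ℕ (λ b → 0 < b × a < 3 * b ×
    (∀ m → 0 < m → Σ ℕ (λ R → ∀ r → R ≤ r → 3 ≤ r → ∀ β → IsBeta₂ r β →
      m * b * β ≤ (m * a + b) * r))))

improvement : ∀ {s₀ n₀} → PairAvoiding s₀ n₀ → n₀ < 3 * s₀ → LinearImprovement
improvement {zero} _ ()
improvement {s₀@(suc _)} {n₀} H n₀<3s₀ =
  n₀ , s₀ , s≤s z≤n , n₀<3s₀ , λ m _ → 3 * m * s₀ , bound m
  where
    regroup : ∀ m a s b → m * (a * s + 3 * b * b) ≡ m * a * s + b * (3 * m * b)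
    regroup = solve-∀

    bound : ∀ m r → 3 * m * s₀ ≤ r → 3 ≤ r → ∀ β → IsBeta₂ r β → m * s₀ * β ≤ (m * n₀ + s₀) * r
    bound m r@(suc (suc s)) R≤r (s≤s (s≤s _)) β isβ with scaledBound H s
    ... | n , Hs , s₀n≤ = begin
      m * s₀ * β                      ≤⟨ *-monoʳ-≤ (m * s₀) (β₂-minimal isβ Hs) ⟩
      m * s₀ * n                      ≡⟨ *-assoc m s₀ n ⟩
      m * (s₀ * n)                    ≤⟨ *-monoʳ-≤ m s₀n≤ ⟩
      m * (n₀ * s + 3 * s₀ * s₀)      ≡⟨ regroup m n₀ s s₀ ⟩
      m * n₀ * s + s₀ * (3 * m * s₀)  ≤⟨ +-mono-≤ (*-monoʳ-≤ (m * n₀) (m≤n+m s 2)) (*-monoʳ-≤ s₀ R≤r) ⟩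
      m * n₀ * r + s₀ * r             ≡⟨ ≡-sym (*-distribʳ-+ r (m * n₀) s₀) ⟩
      (m * n₀ + s₀) * r               ∎
      where open ≤-Reasoning

exact : ¬ LinearImprovement → ∀ r → 3 ≤ r → IsBeta₂ r (3 * r ∸ 6)
exact noImprovement (suc (suc s)) (s≤s (s≤s _)) =
  subst (IsBeta₂ (2 + s)) (≡-sym 3[2+s]∸6≡3s)
    (pairAvoiding⇒good (triples s) ,
     λ n n<3s good → noImprovement (improvement (good⇒pairAvoiding good) n<3s))
  where
    3[2+s]∸6≡3s : 3 * (2 + s) ∸ 6 ≡ 3 * s
    3[2+s]∸6≡3s = trans (cong (_∸ 6) (*-distribˡ-+ 3 2 s)) (m+n∸m≡n 6 (3 * s))

proposition6p1 :
    ¬ ¬ ((∀ r → 3 ≤ r → IsBeta₂ r (3 * r ∸ 6))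
         ⊎ Σ ℕ (λ a → Σ ℕ (λ b → 0 < b × a < 3 * b ×
             (∀ m → 0 < m → Σ ℕ (λ R → ∀ r → R ≤ r → 3 ≤ r → ∀ β → IsBeta₂ r β →
               m * b * β ≤ (m * a + b) * r)))))
proposition6p1 neither = neither (inj₁ (exact (neither ∘ inj₂)))
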